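{- A lattice effect algebra $\mathbf E=(E;\oplus,',0,1)$ is a lattice orthoalgebra if and only if its corresponding effect groupoid $\mathbb R(\mathbf E)=(E;\cdot,',0,1)$ is idempotent, i.e. satisfies $x\cdot x=x$ for all $x\in E$.
   Context: An effect algebra is a partial algebra $(E;\oplus,',0,1)$ with $\oplus$ partial binary, such that: (E1) if $x\oplus y$ exists then $y\oplus x$ exists and equals it; (E2) if $x\oplus y$ and $(x\oplus y)\oplus z$ exist then $y\oplus z$ and $x\oplus(y\oplus z)$ exist and $(x\oplus y)\oplus z=x\oplus(y\oplus z)$; (E3) $x'$ is the unique element with $x\oplus x'$ defined and equal to $1$; (E4) if $x\oplus 1$ exists then $x=0$. Its induced order is $a\leq b$ iff $a\oplus c=b$ for some $c$. A lattice effect algebra is one whose induced order is a lattice, with meet $\wedge$. A lattice orthoalgebra is a lattice effect algebra in which, for all $x$, if $x\oplus x$ exists then $x=0$. The corresponding effect groupoid is $\mathbb R(\mathbf E)=(E;\cdot,',0,1)$ with $x\cdot y:=((x'\wedge y)\oplus y')'$. -}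

module Defs where

open import Level using (Level; suc; _⊔_)
open import Data.Maybe using (Maybe; just)
open import Data.Product using (Σ; ∃; _×_; _,_)
open import Relation.Binary.PropositionalEquality using (_≡_)

-- An effect algebra (E; ⊕, ′, 0, 1); the partial operation ⊕ is modelled
-- as a total function into Maybe E ("x ⊕ y exists" means "x ⊕ y ≡ just z").
record EffectAlgebra (c : Level) : Set (suc c) where
  infixl 6 _⊕_
  infix 8 _′
  field
    Carrier : Set c
    _⊕_ : Carrier → Carrier → Maybe Carrier
    _′ : Carrier → Carrier
    𝟎 : Carrier
    𝟏 : Carrier
    comm : ∀ x y z → x ⊕ y ≡ just z → y ⊕ x ≡ just z
    assoc : ∀ x y z xy xyz → x ⊕ y ≡ just xy → xy ⊕ z ≡ just xyz →
            ∃ λ yz → (y ⊕ z ≡ just yz) × (x ⊕ yz ≡ just xyz)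
    compl : ∀ x → x ⊕ (x ′) ≡ just 𝟏
    compl-unique : ∀ x y → x ⊕ y ≡ just 𝟏 → y ≡ x ′
    zero-one : ∀ x z → x ⊕ 𝟏 ≡ just z → x ≡ 𝟎

  _≤_ : Carrier → Carrier → Set c
  a ≤ b = ∃ λ c → a ⊕ c ≡ just b

record LatticeEffectAlgebra (c : Level) : Set (suc c) where
  field
    effectAlgebra : EffectAlgebra c
  open EffectAlgebra effectAlgebra public
  infixl 7 _∧_
  infixl 6 _∨_
  field
    _∧_ : Carrier → Carrier → Carrier
    ∧-lb₁ : ∀ x y → (x ∧ y) ≤ x
    ∧-lb₂ : ∀ x y → (x ∧ y) ≤ y
    ∧-glb : ∀ x y z → z ≤ x → z ≤ y → z ≤ (x ∧ y)
    _∨_ : Carrier → Carrier → Carrier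
    ∨-ub₁ : ∀ x y → x ≤ (x ∨ y)
    ∨-ub₂ : ∀ x y → y ≤ (x ∨ y)
    ∨-lub : ∀ x y z → x ≤ z → y ≤ z → (x ∨ y) ≤ z

module _ {c : Level} (L : LatticeEffectAlgebra c) where
  open LatticeEffectAlgebra L

  IsLatticeOrthoalgebra : Set c
  IsLatticeOrthoalgebra = ∀ x z → x ⊕ x ≡ just z → x ≡ 𝟎

  -- The effect groupoid product x · y := ((x′ ∧ y) ⊕ y′)′, as a graph:
  -- Prod x y z  iff  (x′ ∧ y) ⊕ y′ exists and its complement is z.
  -- (In every effect algebra this sum always exists, since x′ ∧ y ≤ y.)
  Prod : Carrier → Carrier → Carrier → Set c
  Prod x y z = ∃ λ w → ((x ′ ∧ y) ⊕ (y ′) ≡ just w) × (w ′ ≡ z)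

  IsIdempotentGroupoid : Set c
  IsIdempotentGroupoid = ∀ x → Prod x x x

-- Both conditions are equivalent to the single identity  x′ ∧ x = 0.
--   * Groupoid side: x · x = ((x′ ∧ x) ⊕ x′)′, so x · x = x says exactly
--     that (x′ ∧ x) ⊕ x′ = x′; by cancellation (m ⊕ a = a forces m = 0)
--     this is equivalent to x′ ∧ x = 0.
--   * Orthoalgebra side: m = x′ ∧ x lies below both x and x′, and x ⊕ x′
--     exists, so m ⊕ m exists (orthogonality is inherited downwards), hence
--     m = 0 in an orthoalgebra.  Conversely, if x ⊕ x exists then x ≤ x′,
--     so x ≤ x′ ∧ x = 0 and x = 0.
-- The file first derives the elementary effect-algebra facts used (double
-- complement, neutrality of 0, cancellation, downward closure of
-- orthogonality), then the two characterisations, then the theorem.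
module Submission where

open import Defs
open import Level using (Level)
open import Function.Bundles using (_⇔_; mk⇔)
open import Data.Maybe using (just)
open import Data.Maybe.Properties using (just-injective)
open import Data.Product using (∃; _×_; _,_)
open import Relation.Binary.PropositionalEquality

module EffectAlgebraProperties {c : Level} (E : EffectAlgebra c) where
  open EffectAlgebra E

  _⟂_ : Carrier → Carrier → Set c
  x ⟂ y = ∃ λ s → x ⊕ y ≡ just s

  ′-involutive : ∀ x → x ′ ′ ≡ x
  ′-involutive x = sym (compl-unique (x ′) x (comm _ _ _ (compl x)))

  𝟏′≡𝟎 : 𝟏 ′ ≡ 𝟎
  𝟏′≡𝟎 = zero-one (𝟏 ′) 𝟏 (comm _ _ _ (compl 𝟏))

  assoc⁻¹ : ∀ x y z yz xyz → x ⊕ yz ≡ just xyz → y ⊕ z ≡ just yz →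
            ∃ λ xy → (x ⊕ y ≡ just xy) × (xy ⊕ z ≡ just xyz)
  assoc⁻¹ x y z yz xyz x⊕yz y⊕z
    with assoc z y x yz xyz (comm _ _ _ y⊕z) (comm _ _ _ x⊕yz)
  ... | yx , z⊕y , yx⊕z = yx , comm _ _ _ z⊕y , comm _ _ _ yx⊕z

  -- 0 is a neutral element: y′ ⊕ y = 1 = 1 ⊕ 0 reassociates to y′ ⊕ (y ⊕ 0) = 1.
  ⊕-identityʳ : ∀ y → y ⊕ 𝟎 ≡ just y
  ⊕-identityʳ y with assoc (y ′) y 𝟎 𝟏 𝟏 (comm _ _ _ (compl y)) 𝟏⊕𝟎
    where
    𝟏⊕𝟎 : 𝟏 ⊕ 𝟎 ≡ just 𝟏
    𝟏⊕𝟎 = subst (λ t → 𝟏 ⊕ t ≡ just 𝟏) 𝟏′≡𝟎 (compl 𝟏)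
  ... | s , y⊕𝟎 , y′⊕s = subst (λ t → y ⊕ 𝟎 ≡ just t) s≡y y⊕𝟎
    where
    s≡y : s ≡ y
    s≡y = trans (compl-unique (y ′) s y′⊕s) (′-involutive y)

  ⊕-identityˡ : ∀ y → 𝟎 ⊕ y ≡ just y
  ⊕-identityˡ y = comm _ _ _ (⊕-identityʳ y)

  ≤-refl : ∀ x → x ≤ x
  ≤-refl x = 𝟎 , ⊕-identityʳ x

  -- Cancellation: if m ⊕ a = a then m = 0, since then m ⊕ (a ⊕ a′) = 1.
  ⊕-absorbs⇒𝟎 : ∀ m a → m ⊕ a ≡ just a → m ≡ 𝟎
  ⊕-absorbs⇒𝟎 m a m⊕a with assoc m a (a ′) a 𝟏 m⊕a (compl a)
  ... | s , a⊕a′ , m⊕s = zero-one m 𝟏 (subst (λ t → m ⊕ t ≡ just 𝟏) s≡𝟏 m⊕s)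
    where
    s≡𝟏 : s ≡ 𝟏
    s≡𝟏 = just-injective (trans (sym a⊕a′) (compl a))

  -- Only 0 lies below 0: a ⊕ b = 0 forces a = 0, because b ⊕ 1 is then defined.
  ≤-𝟎 : ∀ x → x ≤ 𝟎 → x ≡ 𝟎
  ≤-𝟎 x (e , x⊕e) with assoc e x 𝟏 𝟎 𝟏 (comm _ _ _ x⊕e) (⊕-identityˡ 𝟏)
  ... | t , x⊕𝟏 , _ = zero-one x t x⊕𝟏

  ⟂-sym : ∀ {x y} → x ⟂ y → y ⟂ x
  ⟂-sym (s , x⊕y) = s , comm _ _ _ x⊕y

  -- Orthogonality is inherited by smaller elements on the left:
  -- from a ⊕ e = b and b ⊕ d defined, a ⊕ (d ⊕ e) is defined, hence a ⊕ d.
  ⟂-antitoneˡ : ∀ {a b d} → a ≤ b → b ⟂ d → a ⟂ d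
  ⟂-antitoneˡ {a} {b} {d} (e , a⊕e) (s , b⊕d)
    with assoc a e d b s a⊕e b⊕d
  ... | ed , e⊕d , a⊕ed with assoc⁻¹ a d e ed s a⊕ed (comm _ _ _ e⊕d)
  ... | ad , a⊕d , _ = ad , a⊕d

  ⟂-antitone : ∀ {a b d c} → a ≤ b → d ≤ c → b ⟂ c → a ⟂ d
  ⟂-antitone a≤b d≤c b⟂c =
    ⟂-antitoneˡ a≤b (⟂-sym (⟂-antitoneˡ d≤c (⟂-sym b⟂c)))

  -- If a ⊕ b is defined then b ≤ a′: with s = a ⊕ b, a ⊕ (b ⊕ s′) = 1.
  ⟂⇒≤′ : ∀ {a b} → a ⟂ b → b ≤ (a ′)
  ⟂⇒≤′ {a} {b} (s , a⊕b) with assoc a b (s ′) s 𝟏 a⊕b (compl s)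
  ... | t , b⊕s′ , a⊕t = s ′ , subst (λ u → b ⊕ s ′ ≡ just u) (compl-unique a t a⊕t) b⊕s′

module LatticeEffectAlgebraProperties {c : Level} (L : LatticeEffectAlgebra c) where
  open LatticeEffectAlgebra L
  open EffectAlgebraProperties effectAlgebra

  meet-𝟎⇒idempotent : ∀ x → x ′ ∧ x ≡ 𝟎 → Prod L x x x
  meet-𝟎⇒idempotent x m≡𝟎 =
    x ′ , subst (λ m → m ⊕ x ′ ≡ just (x ′)) (sym m≡𝟎) (⊕-identityˡ (x ′)) , ′-involutive x

  idempotent⇒meet-𝟎 : ∀ x → Prod L x x x → x ′ ∧ x ≡ 𝟎
  idempotent⇒meet-𝟎 x (w , m⊕x′ , w′≡x) =
    ⊕-absorbs⇒𝟎 (x ′ ∧ x) (x ′) (subst (λ u → x ′ ∧ x ⊕ x ′ ≡ just u) w≡x′ m⊕x′)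
    where
    w≡x′ : w ≡ x ′
    w≡x′ = begin
      w       ≡⟨ sym (′-involutive w) ⟩
      w ′ ′   ≡⟨ cong _′ w′≡x ⟩
      x ′     ∎
      where open ≡-Reasoning

  -- In an orthoalgebra x′ ∧ x = 0, since x′ ∧ x is orthogonal to itself.
  orthoalgebra⇒meet-𝟎 : IsLatticeOrthoalgebra L → ∀ x → x ′ ∧ x ≡ 𝟎
  orthoalgebra⇒meet-𝟎 ortho x with ⟂-antitone (∧-lb₂ (x ′) x) (∧-lb₁ (x ′) x) (𝟏 , compl x)
  ... | s , m⊕m = ortho (x ′ ∧ x) s m⊕m

  -- If x′ ∧ x = 0 always, then x ⊕ x defined gives x ≤ x′ ∧ x = 0.
  meet-𝟎⇒orthoalgebra : (∀ x → x ′ ∧ x ≡ 𝟎) → IsLatticeOrthoalgebra L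
  meet-𝟎⇒orthoalgebra meet-𝟎 x s x⊕x =
    ≤-𝟎 x (subst (x ≤_) (meet-𝟎 x) (∧-glb (x ′) x x (⟂⇒≤′ (s , x⊕x)) (≤-refl x)))

mainTheorem5 : ∀ {c : Level} (L : LatticeEffectAlgebra c) →
    IsLatticeOrthoalgebra L ⇔ IsIdempotentGroupoid L
mainTheorem5 L = mk⇔
  (λ ortho x → meet-𝟎⇒idempotent x (orthoalgebra⇒meet-𝟎 ortho x))
  (λ idem → meet-𝟎⇒orthoalgebra (λ x → idempotent⇒meet-𝟎 x (idem x)))
  where open LatticeEffectAlgebraProperties L
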